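{- Let $G$ be a graph and $c$ an $r$-edge-colouring of $G$. Then: (a) the minimum number of monochromatic components (under $c$) needed to cover $V(G)$ equals $\tau(H(G,c))$; in particular $\mathrm{tc}_r(G) \ge \tau(H(G,c))$; (b) for any $W \subseteq V(G)$, $\tau(H(G,W,c)) \le \tau(H(G,c))$; (c) if $\tau(H(G,c)) \ge s$, there exists $W \subseteq V(G)$ with $|W| \le N_{r,s} = \binom{r-1+s}{r}$ such that $\tau(H(G,W,c)) \ge s$; (d) for any $W \subseteq V(G)$ and any edge $uv \in E(G)$, with $\mathrm{ed} = \mathrm{ed}(G,W,c)$, the edges $\mathrm{ed}(u)$ and $\mathrm{ed}(v)$ intersect; (e) for any $W, A \subseteq V(G)$, with $H = H(G,W,c)$ and $\mathrm{ed} = \mathrm{ed}(G,W,c)$, there is $f \in E(H)$ such that the number of $u \in A$ with $\mathrm{ed}(u) = f$ is at least $\frac{|A|}{(|W|+1)^r}$.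
   Context: A monochromatic component of colour $i$ under $c$ is a connected component (possibly a single vertex) of the spanning subgraph of $G$ formed by the edges of colour $i$. Given $W \subseteq V(G)$, the $r$-partite $r$-uniform hypergraph $H = H(G,W,c)$ has parts indexed by colours $1,\dots,r$; part $i$ contains a distinct vertex $\mathrm{vt}(C)$ for every monochromatic component $C$ of colour $i$ with $C \cap W \ne \emptyset$, and one additional special vertex $v_i^*$; for every colour-$i$ component $C$ with $C \cap W = \emptyset$ we set $\mathrm{vt}(C) = v_i^*$. For each $u \in V(G)$, $\mathrm{ed}(u) = \mathrm{ed}(G,W,c)(u) = \{\mathrm{vt}(C_i) : i \in [r]\}$, where $C_i$ is the colour-$i$ component containing $u$; the edge set of $H$ is $\{\mathrm{ed}(u) : u \in V(G)\}$. Write $H(G,c) = H(G,V(G),c)$. A cover of a hypergraph is a set of vertices meeting every edge and $\tau$ denotes the minimum size of a cover. $\mathrm{tc}_r(G)$ is the minimum $m$ such that for every $r$-colouring of $E(G)$ there are $m$ monochromatic components covering $V(G)$. -}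

module Defs where

open import Data.Nat using (ℕ; suc; _+_; _*_; _∸_; _^_; _≤_)
open import Data.Nat.Combinatorics using (_C_)
open import Data.Bool using (Bool; true; false; T)
open import Data.Fin using (Fin)
open import Data.Fin.Subset using (Subset; _∈_; _∉_)
open import Data.Maybe using (Maybe; just; nothing)
open import Data.List using (List; length)
open import Data.List.Relation.Unary.All using (All)
open import Data.List.Relation.Unary.Any using (Any)
open import Data.Product using (Σ; ∃; _×_; _,_; proj₁; proj₂)
open import Data.Sum using (_⊎_)
open import Data.Unit using (⊤)
open import Relation.Nullary using (¬_)
open import Relation.Binary.PropositionalEquality using (_≡_)

record Graph (n : ℕ) : Set where
  field
    adj    : Fin n → Fin n → Bool
    sym    : ∀ u v → adj u v ≡ adj v u
    irrefl : ∀ u → adj u u ≡ false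

open Graph public

Edge : ∀ {n} → Graph n → Fin n → Fin n → Set
Edge G u v = T (adj G u v)

-- An r-edge-colouring: a symmetric colour assignment to pairs of vertices;
-- only its values on edges matter.
record Colouring {n : ℕ} (G : Graph n) (r : ℕ) : Set where
  field
    col     : Fin n → Fin n → Fin r
    col-sym : ∀ u v → col u v ≡ col v u

open Colouring public

module _ {n r : ℕ} {G : Graph n} (c : Colouring G r) where

  MonoEdge : Fin r → Fin n → Fin n → Set
  MonoEdge i u v = Edge G u v × col c u v ≡ i

  data Conn (i : Fin r) : Fin n → Fin n → Set where
    here : ∀ {u} → Conn i u u
    step : ∀ {u v w} → MonoEdge i u v → Conn i v w → Conn i u w

  Miss : Subset n → Fin r → Fin n → Set
  Miss W i u = ∀ x → x ∈ W → ¬ Conn i u x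

  -- V(G) is covered by at most k monochromatic components; a component is
  -- given by a (colour, representative vertex) pair.
  CompCover : ℕ → Set
  CompCover k = Σ (List (Fin r × Fin n)) λ L → length L ≤ k ×
    (∀ u → Any (λ p → Conn (proj₁ p) (proj₂ p) u) L)

  -- Vertices of H(G,W,c): (i , just w) with w ∈ W stands for vt of the
  -- colour-i component of w; (i , nothing) stands for v_i^*.
  HVertex : Set
  HVertex = Fin r × Maybe (Fin n)

  Valid : Subset n → HVertex → Set
  Valid W (i , just w) = w ∈ W
  Valid W (i , nothing) = ⊤

  -- the vertex p of H(G,W,c) lies in the edge ed(u), i.e. p = vt(C_i(u))
  InEd : Subset n → HVertex → Fin n → Set
  InEd W (i , just w) u = Conn i u w
  InEd W (i , nothing) u = Miss W i u

  IsCover : Subset n → List HVertex → Set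
  IsCover W L = All (Valid W) L × (∀ u → Any (λ p → InEd W p u) L)

  HasCover : Subset n → ℕ → Set
  HasCover W k = Σ (List HVertex) λ L → length L ≤ k × IsCover W L

  -- τ(H(G,W,c)) ≥ s  (τ = ∞ if there is no cover)
  τ≥ : Subset n → ℕ → Set
  τ≥ W s = ∀ k → HasCover W k → s ≤ k

  SameVt : Subset n → Fin r → Fin n → Fin n → Set
  SameVt W i u v = Conn i u v ⊎ (Miss W i u × Miss W i v)

  SameEd : Subset n → Fin n → Fin n → Set
  SameEd W u v = ∀ i → SameVt W i u v

N : ℕ → ℕ → ℕ
N r s = ((r ∸ 1) + s) C r

-- The edge ed(u) of H(G,W,c) records, colour by colour, the monochromatic component through u (or v_i^*
-- when that component misses W). So covers of H(G,c) are covers of V(G) by components; moving each vertex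
-- of a cover of H(G,c) to the corresponding vertex of H(G,W,c) gives a cover of H(G,W,c); and the ends of
-- an edge share the component of its colour. For (e), split A by the colour-i vertex of ed(u), one colour
-- at a time: there are at most |W| + 1 classes, and the largest keeps a 1/(|W| + 1) fraction of A.
-- For (c), take W ⊆ V(G) minimal such that the edges ed(w), w ∈ W, of H(G,c) have no cover of size < s.
-- Each w ∈ W has a cover B_w of size < s of the other edges, so ed(w) ∩ B_w = ∅ while ed(w) meets every
-- other B_w′. Bollobás's inequality Σ_w 1 / C(r + |B_w|, r) ≤ 1, proved by counting the orderings of the
-- ground set in which ed(w) precedes B_w, bounds |W| by C(r - 1 + s, r). A cover of H(G,W,c) of size < s
-- would yield such a cover of the edges ed(w), w ∈ W, so τ(H(G,W,c)) ≥ s.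

module Submission where

open import Defs hiding (sym)
open import Data.Nat using (ℕ; zero; suc; _+_; _*_; _∸_; _^_; _≤_; _<_; z≤n; s≤s; _≤?_; _!; _/_)
open import Data.Nat.Properties hiding (_≟_)
open import Data.Nat.Properties using () renaming (_≟_ to _≟ℕ_)
open import Data.Nat.Combinatorics
  using (_C_; nCk≡n!/k![n-k]!; k![n∸k]!∣n!; nCk+nC[k+1]≡[n+1]C[k+1]; nCn≡1; nCk≡nC[n∸k])
open import Data.Nat.Divisibility using (∣-trans; n∣m*n; m≤n⇒m!∣n!)
open import Data.Nat.DivMod using (m/n*n≡m)
open import Data.Nat.Tactic.RingSolver using (solve-∀)
open import Data.Bool using (Bool; true; false; T; _∧_; _∨_; not; if_then_else_)
open import Data.Bool.Properties using (T?; ∨-zeroʳ) renaming (_≟_ to _≟𝔹_)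
open import Data.Fin using (Fin; zero; suc; _≟_; _↑ˡ_; _↑ʳ_; combine; remQuot)
open import Data.Fin.Properties using (any?; all?; remQuot-combine)
import Data.Fin.Properties as Finₚ
open import Data.Fin.Subset using (Subset; _∈_; _⊆_; ∣_∣) renaming (⊤ to full; ⊥ to ∅)
open import Data.Fin.Subset.Properties using (∈⊤; _∈?_; anySubset?)
open import Data.Vec using (_∷_; []; lookup; tabulate)
open import Data.Vec.Properties using (lookup∘tabulate; []=⇒lookup; lookup⇒[]=)
open import Data.Maybe using (Maybe; just; nothing; fromMaybe)
import Data.Maybe as Maybe
open import Data.Maybe.Properties using () renaming (≡-dec to ≡-decᴹ)
open import Data.List using (List; []; _∷_; length; map; allFin)
open import Data.List.Properties using (length-map; length-tabulate)
open import Data.List.Membership.Propositional using (lose) renaming (_∈_ to _∈ˡ_)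
open import Data.List.Membership.Propositional.Properties using (∈-map⁺; ∈-allFin)
open import Data.List.Relation.Unary.All as All using (All)
import Data.List.Relation.Unary.All.Properties as All
open import Data.List.Relation.Unary.Any as Any using (Any; here; there)
import Data.List.Relation.Unary.Any.Properties as Any
open import Data.Product using (∃; _×_; _,_; proj₁; proj₂)
open import Data.Sum using (_⊎_; inj₁; inj₂)
open import Data.Unit using (tt)
open import Function using (_∘_)
open import Function.Bundles using (_⇔_; mk⇔; Equivalence)
open import Relation.Binary using (Rel; Decidable; IsDecEquivalence)
open import Relation.Binary.Construct.Closure.ReflexiveTransitive using (Star; ε; _◅_; _◅◅_)
open import Relation.Nullary using (¬_; Dec; does; yes; no)
open import Relation.Nullary.Decidable using (_×-dec_; _→-dec_; ¬?; map′; dec-true; dec-false)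
open import Relation.Nullary.Negation using (contradiction)
open import Relation.Binary.PropositionalEquality
open import Algebra.Properties.Semiring.Sum +-*-semiring
  using (sum; sum-syntax; sum-cong-≗; ∑-distrib-+; ∑-comm; *-distribˡ-sum; *-distribʳ-sum)

∑-const : ∀ m c → ∑[ x < m ] c ≡ m * c
∑-const zero    c = refl
∑-const (suc m) c = cong (c +_) (∑-const m c)

∑-zero : ∀ {m} (f : Fin m → ℕ) → (∀ x → f x ≡ 0) → sum f ≡ 0
∑-zero {m} f f≡0 = trans (sum-cong-≗ f≡0) (trans (∑-const m 0) (*-zeroʳ m))

∑-*ʳ : ∀ {m} (f : Fin m → ℕ) c → ∑[ x < m ] (f x * c) ≡ sum f * c
∑-*ʳ f c = sym (*-distribʳ-sum c f)

∑-mono-≤ : ∀ {m} (f g : Fin m → ℕ) → (∀ x → f x ≤ g x) → sum f ≤ sum g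
∑-mono-≤ {zero}  f g f≤g = z≤n
∑-mono-≤ {suc m} f g f≤g = +-mono-≤ (f≤g zero) (∑-mono-≤ (f ∘ suc) (g ∘ suc) (f≤g ∘ suc))

∑-mono-< : ∀ {m} (f g : Fin m → ℕ) → (∀ x → f x ≤ g x) → ∃ (λ x → f x < g x) → sum f < sum g
∑-mono-< f g f≤g (zero , lt)  = +-mono-<-≤ lt (∑-mono-≤ (f ∘ suc) (g ∘ suc) (f≤g ∘ suc))
∑-mono-< f g f≤g (suc x , lt) =
  +-mono-≤-< (f≤g zero) (∑-mono-< (f ∘ suc) (g ∘ suc) (f≤g ∘ suc) (x , lt))

∑-pointSupported : ∀ {m} (a : Fin m) (f : Fin m → ℕ) → (∀ x → x ≢ a → f x ≡ 0) → sum f ≡ f a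
∑-pointSupported {suc m} zero f f≡0 =
  trans (cong (f zero +_) (∑-zero (f ∘ suc) (λ x → f≡0 (suc x) λ ())) ) (+-identityʳ _)
∑-pointSupported {suc m} (suc a) f f≡0 =
  trans (cong (_+ sum (f ∘ suc)) (f≡0 zero λ ()))
        (∑-pointSupported a (f ∘ suc) (λ x x≢a → f≡0 (suc x) (x≢a ∘ Finₚ.suc-injective)))

∑-split : ∀ a b (f : Fin (a + b) → ℕ) →
  sum f ≡ ∑[ x < a ] f (x ↑ˡ b) + ∑[ y < b ] f (a ↑ʳ y)
∑-split zero    b f = refl
∑-split (suc a) b f = trans (cong (f zero +_) (∑-split a b (f ∘ suc))) (sym (+-assoc (f zero) _ _))

∑-combine : ∀ r n (f : Fin (r * n) → ℕ) → sum f ≡ ∑[ i < r ] ∑[ x < n ] f (combine i x)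
∑-combine zero    n f = refl
∑-combine (suc r) n f =
  trans (∑-split n (r * n) f)
        (cong (∑[ x < n ] f (x ↑ˡ r * n) +_) (∑-combine r n (λ z → f (n ↑ʳ z))))

χ : Bool → ℕ
χ true  = 1
χ false = 0

_≟ᵇ_ : ∀ {m} → Fin m → Fin m → Bool
x ≟ᵇ y = does (x ≟ y)

dec-true⁻¹ : ∀ {a} {A : Set a} (a? : Dec A) → does a? ≡ true → A
dec-true⁻¹ (yes a) _ = a

≟ᵇ-refl : ∀ {m} (x : Fin m) → (x ≟ᵇ x) ≡ true
≟ᵇ-refl x = dec-true (x ≟ x) refl

≟ᵇ-true : ∀ {m} {x y : Fin m} → (x ≟ᵇ y) ≡ true → x ≡ y
≟ᵇ-true {x = x} {y} = dec-true⁻¹ (x ≟ y)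

≟ᵇ-false : ∀ {m} {x y : Fin m} → x ≢ y → (x ≟ᵇ y) ≡ false
≟ᵇ-false {x = x} {y} = dec-false (x ≟ y)

∧-true⁻ : ∀ {a b} → (a ∧ b) ≡ true → a ≡ true × b ≡ true
∧-true⁻ {true} {true} _ = refl , refl

count : ∀ {m} → (Fin m → Bool) → ℕ
count P = ∑[ x < _ ] χ (P x)

count-singleton : ∀ {m} (a : Fin m) → count (_≟ᵇ a) ≡ 1
count-singleton a = trans (∑-pointSupported a _ (λ x x≢a → cong χ (≟ᵇ-false x≢a)))
                          (cong χ (≟ᵇ-refl a))

count-all : ∀ m → count {m} (λ _ → true) ≡ m
count-all m = trans (∑-const m 1) (*-identityʳ m)

count-mono : ∀ {m} {P Q : Fin m → Bool} → (∀ {z} → P z ≡ true → Q z ≡ true) → count P ≤ count Q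
count-mono {P = P} {Q} P⊆Q = ∑-mono-≤ _ _ λ z → χ-mono (P z) (Q z) P⊆Q
  where
  χ-mono : ∀ a b → (a ≡ true → b ≡ true) → χ a ≤ χ b
  χ-mono false b   _ = z≤n
  χ-mono true  b imp rewrite imp refl = ≤-refl

count≤ : ∀ {m} (P : Fin m → Bool) → count P ≤ m
count≤ {m} P = ≤-trans (count-mono {P = P} {λ _ → true} λ _ → refl) (≤-reflexive (count-all m))

_─_ : ∀ {m} → (Fin m → Bool) → Fin m → Fin m → Bool
(P ─ x) z = P z ∧ not (z ≟ᵇ x)

─-intro : ∀ {m} {P : Fin m → Bool} {x z} → P z ≡ true → z ≢ x → (P ─ x) z ≡ true
─-intro {x = x} {z} Pz z≢x rewrite Pz | ≟ᵇ-false z≢x = refl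

─-elim : ∀ {m} {P : Fin m → Bool} {x z} → (P ─ x) z ≡ true → P z ≡ true × z ≢ x
─-elim {P = P} {x} {z} eq with P z | z ≟ x
... | true | no z≢x = refl , z≢x

count-remove : ∀ {m} (P : Fin m → Bool) x → count P ≡ χ (P x) + count (P ─ x)
count-remove P x = begin
  count P                                     ≡⟨ sum-cong-≗ split ⟩
  ∑[ z < _ ] (atX z + χ ((P ─ x) z))          ≡⟨ ∑-distrib-+ atX _ ⟩
  sum atX + count (P ─ x)                     ≡⟨ cong (_+ count (P ─ x)) (∑-pointSupported x atX offX) ⟩
  atX x + count (P ─ x)                       ≡⟨ cong (_+ count (P ─ x)) atX-x ⟩
  χ (P x) + count (P ─ x)                     ∎
  where
  open ≡-Reasoning
  atX : Fin _ → ℕ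
  atX z = if z ≟ᵇ x then χ (P z) else 0
  offX : ∀ z → z ≢ x → atX z ≡ 0
  offX z z≢x rewrite ≟ᵇ-false z≢x = refl
  atX-x : atX x ≡ χ (P x)
  atX-x rewrite ≟ᵇ-refl x = refl
  split : ∀ z → χ (P z) ≡ atX z + χ ((P ─ x) z)
  split z with z ≟ᵇ x | P z
  ... | true  | true  = refl
  ... | true  | false = refl
  ... | false | true  = refl
  ... | false | false = refl

count-remove-∈ : ∀ {m} (P : Fin m → Bool) {x} → P x ≡ true → count P ≡ suc (count (P ─ x))
count-remove-∈ P {x} Px = trans (count-remove P x) (cong (λ b → χ b + count (P ─ x)) Px)

count≡0⇒∉ : ∀ {m} {P : Fin m → Bool} → count P ≡ 0 → ∀ z → P z ≢ true
count≡0⇒∉ {P = P} |P|≡0 z Pz = contradiction (trans (sym |P|≡0) (count-remove-∈ P Pz)) λ ()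

count-disjoint : ∀ {m} (P Q : Fin m → Bool) → (∀ {z} → P z ≡ true → Q z ≢ true) →
                 count P + count Q ≤ m
count-disjoint {m} P Q P∩Q = begin
  count P + count Q                 ≡⟨ sym (∑-distrib-+ (χ ∘ P) (χ ∘ Q)) ⟩
  ∑[ z < m ] (χ (P z) + χ (Q z))    ≤⟨ ∑-mono-≤ _ _ atMostOne ⟩
  ∑[ z < m ] 1                      ≡⟨ count-all m ⟩
  m                                 ∎
  where
  open ≤-Reasoning
  atMostOne : ∀ z → χ (P z) + χ (Q z) ≤ 1
  atMostOne z with P z in Pz | Q z in Qz
  ... | true  | true  = contradiction Qz (P∩Q Pz)
  ... | true  | false = ≤-refl
  ... | false | true  = ≤-refl
  ... | false | false = z≤n

count-∨ : ∀ {m} (P Q : Fin m → Bool) → count (λ z → P z ∨ Q z) ≤ count P + count Q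
count-∨ P Q =
  ≤-trans (∑-mono-≤ _ _ λ z → χ-∨ (P z) (Q z)) (≤-reflexive (∑-distrib-+ (χ ∘ P) (χ ∘ Q)))
  where
  χ-∨ : ∀ a b → χ (a ∨ b) ≤ χ a + χ b
  χ-∨ true  b = s≤s z≤n
  χ-∨ false b = ≤-refl

∣∣≡count-lookup : ∀ {m} (p : Subset m) → ∣ p ∣ ≡ count (lookup p)
∣∣≡count-lookup []          = refl
∣∣≡count-lookup (true ∷ p)  = cong suc (∣∣≡count-lookup p)
∣∣≡count-lookup (false ∷ p) = ∣∣≡count-lookup p

∣tabulate∣≡count : ∀ {m} (P : Fin m → Bool) → ∣ tabulate P ∣ ≡ count P
∣tabulate∣≡count P =
  trans (∣∣≡count-lookup (tabulate P)) (sum-cong-≗ (λ x → cong χ (lookup∘tabulate P x)))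

∈-tabulate⁻ : ∀ {m} {P : Fin m → Bool} {x} → x ∈ tabulate P → P x ≡ true
∈-tabulate⁻ {P = P} {x} x∈ = trans (sym (lookup∘tabulate P x)) ([]=⇒lookup x∈)

∈-tabulate⁺ : ∀ {m} {P : Fin m → Bool} {x} → P x ≡ true → x ∈ tabulate P
∈-tabulate⁺ {P = P} {x} Px = lookup⇒[]= x _ (trans (lookup∘tabulate P x) Px)

pickMember : ∀ {m} → 1 ≤ m → (P : Fin m → Bool) → ∃ λ w → ∀ {x} → P x ≡ true → P w ≡ true
pickMember {suc m} _ P with any? (λ x → P x ≟𝔹 true)
... | yes (w , Pw) = w , λ _ → Pw
... | no P≡∅       = zero , λ {x} Px → contradiction (x , Px) P≡∅

members : ∀ {k} → (Fin k → Bool) → List (Fin k)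
members {zero}  P = []
members {suc k} P = if P zero then zero ∷ rest else rest
  where rest = map suc (members (P ∘ suc))

length-members : ∀ {k} (P : Fin k → Bool) → length (members P) ≡ count P
length-members {zero}  P = refl
length-members {suc k} P with P zero
... | true  = cong suc (trans (length-map suc (members (P ∘ suc))) (length-members (P ∘ suc)))
... | false = trans (length-map suc (members (P ∘ suc))) (length-members (P ∘ suc))

∈-members : ∀ {k} (P : Fin k → Bool) {x} → P x ≡ true → x ∈ˡ members P
∈-members {suc k} P {zero}  Px rewrite Px = here refl
∈-members {suc k} P {suc x} Px with P zero
... | true  = there (∈-map⁺ suc (∈-members (P ∘ suc) Px))
... | false = ∈-map⁺ suc (∈-members (P ∘ suc) Px)

module Reachability {n ℓ} {_⟶_ : Rel (Fin n) ℓ} (_⟶?_ : Decidable _⟶_) (u : Fin n) where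

  Closed : (Fin n → Bool) → Set ℓ
  Closed S = ∀ {y z} → S y ≡ true → y ⟶ z → S z ≡ true

  Exit : (Fin n → Bool) → Fin n → Set ℓ
  Exit S z = ∃ λ y → S y ≡ true × y ⟶ z

  exit? : ∀ S z → Dec (Exit S z)
  exit? S z = any? λ y → (S y ≟𝔹 true) ×-dec (y ⟶? z)

  Escape : (Fin n → Bool) → Set ℓ
  Escape S = ∃ λ y → ∃ λ z → S y ≡ true × y ⟶ z × S z ≡ false

  closed? : ∀ S → Closed S ⊎ Escape S
  closed? S with any? (λ y → any? λ z → (S y ≟𝔹 true) ×-dec (y ⟶? z) ×-dec (S z ≟𝔹 false))
  ... | yes (y , z , esc) = inj₂ (y , z , esc)
  ... | no ¬esc = inj₁ closed
    where
    closed : Closed S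
    closed {y} {z} y∈ y⟶z with S z in eq
    ... | true  = refl
    ... | false = contradiction (y , z , y∈ , y⟶z , eq) ¬esc

  reached : ℕ → Fin n → Bool
  reached zero    z = z ≟ᵇ u
  reached (suc k) z = reached k z ∨ does (exit? (reached k) z)

  reached-suc : ∀ k {z} → reached k z ≡ true → reached (suc k) z ≡ true
  reached-suc k eq rewrite eq = refl

  reached-start : ∀ k → reached k u ≡ true
  reached-start zero    = ≟ᵇ-refl u
  reached-start (suc k) = reached-suc k (reached-start k)

  reached-exit : ∀ k {z} → Exit (reached k) z → reached (suc k) z ≡ true
  reached-exit k {z} e with reached k z
  ... | true  = refl
  ... | false with exit? (reached k) z
  ...   | yes _  = refl
  ...   | no ¬e  = contradiction e ¬e

  reached-new : ∀ k {z} → reached (suc k) z ≡ true → reached k z ≡ true ⊎ Exit (reached k) z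
  reached-new k {z} eq with reached k z
  ... | true  = inj₁ refl
  ... | false with exit? (reached k) z
  ...   | yes e = inj₂ e

  reached-sound : ∀ k {z} → reached k z ≡ true → Star _⟶_ u z
  reached-sound zero    eq = subst (Star _⟶_ u) (sym (≟ᵇ-true eq)) ε
  reached-sound (suc k) eq with reached-new k eq
  ... | inj₁ old           = reached-sound k old
  ... | inj₂ (y , y∈ , y⟶z) = reached-sound k y∈ ◅◅ y⟶z ◅ ε

  closed-complete : ∀ {S} → Closed S → ∀ {v w} → S v ≡ true → Star _⟶_ v w → S w ≡ true
  closed-complete closed v∈ ε            = v∈
  closed-complete closed v∈ (v⟶ ◅ path) = closed-complete closed (closed v∈ v⟶) path

  -- Until the frontier closes, every round adds a vertex, so at most n rounds are needed.
  closed-or-large : ∀ k → Closed (reached k) ⊎ suc k ≤ count (reached k)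
  closed-or-large zero = inj₂ (≤-reflexive (sym (count-singleton u)))
  closed-or-large (suc k) with closed? (reached k)
  ...   | inj₁ closed = inj₁ (closed-suc closed)
    where
    closed-suc : Closed (reached k) → Closed (reached (suc k))
    closed-suc closed y∈ y⟶z with reached-new k y∈
    ... | inj₁ old             = reached-suc k (closed old y⟶z)
    ... | inj₂ (x , x∈ , x⟶y)  = reached-suc k (closed (closed x∈ x⟶y) y⟶z)
  ...   | inj₂ (y , z , y∈ , y⟶z , z∉) with closed-or-large k
  ...     | inj₁ closed = contradiction (trans (sym (closed y∈ y⟶z)) z∉) λ ()
  ...     | inj₂ large  = inj₂ (≤-trans (s≤s large) (∑-mono-< _ _ grow (z , new)))
    where
    grow : ∀ x → χ (reached k x) ≤ χ (reached (suc k) x)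
    grow x with reached k x
    ... | true  = ≤-refl
    ... | false = z≤n
    new : χ (reached k z) < χ (reached (suc k) z)
    new = subst₂ (λ a b → χ a < χ b) (sym z∉) (sym (reached-exit k (y , y∈ , y⟶z))) (s≤s z≤n)

  reached-closed : Closed (reached n)
  reached-closed with closed-or-large n
  ... | inj₁ closed = closed
  ... | inj₂ large  = contradiction (≤-trans large (count≤ (reached n))) (<-irrefl refl)

  star? : ∀ v → Dec (Star _⟶_ u v)
  star? v with reached n v in eq
  ... | true  = yes (reached-sound n eq)
  ... | false = no λ path → contradiction
    (trans (sym (closed-complete reached-closed (reached-start n) path)) eq) λ ()

findFirst : ∀ {k} → (Fin k → Bool) → Maybe (Fin k)
findFirst {zero}  P = nothing
findFirst {suc k} P = if P zero then just zero else Maybe.map suc (findFirst (P ∘ suc))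

findFirst-cong : ∀ {k} {P Q : Fin k → Bool} → (∀ x → P x ≡ Q x) → findFirst P ≡ findFirst Q
findFirst-cong {zero}  P≗Q = refl
findFirst-cong {suc k} P≗Q rewrite P≗Q zero | findFirst-cong (P≗Q ∘ suc) = refl

findFirst-complete : ∀ {k} (P : Fin k → Bool) {x} → P x ≡ true → ∃ λ y → findFirst P ≡ just y
findFirst-complete {suc k} P {zero} Px rewrite Px = zero , refl
findFirst-complete {suc k} P {suc x} Px with P zero
... | true  = zero , refl
... | false with findFirst-complete (P ∘ suc) Px
...   | y , eq rewrite eq = suc y , refl

findFirst-sound : ∀ {k} (P : Fin k → Bool) {y} → findFirst P ≡ just y → P y ≡ true
findFirst-sound {suc k} P eq with P zero in P0
findFirst-sound {suc k} P refl | true = P0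
findFirst-sound {suc k} P eq   | false with findFirst (P ∘ suc) in eq′
findFirst-sound {suc k} P refl | false | just y = findFirst-sound (P ∘ suc) eq′

module Representatives {n ℓ} {_~_ : Rel (Fin n) ℓ} (~-isDecEquivalence : IsDecEquivalence _~_) where

  open IsDecEquivalence ~-isDecEquivalence using ()
    renaming (_≟_ to _~?_; refl to ~-refl; sym to ~-sym; trans to ~-trans)

  classOf : Fin n → Fin n → Bool
  classOf u x = does (u ~? x)

  classOf-cong : ∀ {u v} → u ~ v → ∀ x → classOf u x ≡ classOf v x
  classOf-cong {u} {v} u~v x with u ~? x | v ~? x
  ... | yes _   | yes _   = refl
  ... | no _    | no _    = refl
  ... | yes u~x | no v≁x  = contradiction (~-trans (~-sym u~v) u~x) v≁x
  ... | no u≁x  | yes v~x = contradiction (~-trans u~v v~x) u≁x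

  rep : Fin n → Fin n
  rep u = fromMaybe u (findFirst (classOf u))

  rep-~ : ∀ u → u ~ rep u
  rep-~ u with findFirst (classOf u) in eq
  ... | nothing = ~-refl
  ... | just y  = dec-true⁻¹ (u ~? y) (findFirst-sound (classOf u) eq)

  rep-cong : ∀ {u v} → u ~ v → rep u ≡ rep v
  rep-cong {u} {v} u~v = trans (cong (fromMaybe u) eq) (sym (cong (fromMaybe v) eq′))
    where
    found = findFirst-complete (classOf u) (dec-true (u ~? u) ~-refl)
    y = proj₁ found
    eq : findFirst (classOf u) ≡ just y
    eq = proj₂ found
    eq′ : findFirst (classOf v) ≡ just y
    eq′ = trans (sym (findFirst-cong (classOf-cong u~v))) eq

module _ {n r} {G : Graph n} (c : Colouring G r) where

  MonoEdge-sym : ∀ {i u v} → MonoEdge c i u v → MonoEdge c i v u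
  MonoEdge-sym {u = u} {v} (uv , col≡i) = subst T (Graph.sym G u v) uv , trans (col-sym c v u) col≡i

  MonoEdge? : ∀ i → Decidable (MonoEdge c i)
  MonoEdge? i u v = T? (adj G u v) ×-dec (col c u v ≟ i)

  Conn-trans : ∀ {i u v w} → Conn c i u v → Conn c i v w → Conn c i u w
  Conn-trans here       q = q
  Conn-trans (step e p) q = step e (Conn-trans p q)

  Conn-sym : ∀ {i u v} → Conn c i u v → Conn c i v u
  Conn-sym here       = here
  Conn-sym (step e p) = Conn-trans (Conn-sym p) (step (MonoEdge-sym e) here)

  Star⇒Conn : ∀ {i u v} → Star (MonoEdge c i) u v → Conn c i u v
  Star⇒Conn ε        = here
  Star⇒Conn (e ◅ es) = step e (Star⇒Conn es)

  Conn⇒Star : ∀ {i u v} → Conn c i u v → Star (MonoEdge c i) u v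
  Conn⇒Star here       = ε
  Conn⇒Star (step e p) = e ◅ Conn⇒Star p

  Conn? : ∀ i → Decidable (Conn c i)
  Conn? i u v = map′ Star⇒Conn Conn⇒Star (Reachability.star? (MonoEdge? i) u v)

  Conn-isDecEquivalence : ∀ i → IsDecEquivalence (Conn c i)
  Conn-isDecEquivalence i = record
    { isEquivalence = record { refl = here ; sym = Conn-sym ; trans = Conn-trans }
    ; _≟_ = Conn? i
    }

  rep : Fin r → Fin n → Fin n
  rep i = Representatives.rep (Conn-isDecEquivalence i)

  Conn-rep : ∀ i u → Conn c i u (rep i u)
  Conn-rep i = Representatives.rep-~ (Conn-isDecEquivalence i)

  rep-cong : ∀ i {u v} → Conn c i u v → rep i u ≡ rep i v
  rep-cong i = Representatives.rep-cong (Conn-isDecEquivalence i)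

  componentVertex : Fin r × Fin n → HVertex c
  componentVertex (i , v) = i , just v

  components : List (HVertex c) → List (Fin r × Fin n)
  components []                  = []
  components ((i , just w) ∷ L)  = (i , w) ∷ components L
  components ((i , nothing) ∷ L) = components L

  length-components : ∀ L → length (components L) ≤ length L
  length-components []                  = z≤n
  length-components ((i , just w) ∷ L)  = s≤s (length-components L)
  length-components ((i , nothing) ∷ L) = ≤-trans (length-components L) (n≤1+n _)

  -- In H(G,c) the special vertices v_i^* lie in no edge.
  components-cover : ∀ L u → Any (λ p → InEd c full p u) L →
                     Any (λ p → Conn c (proj₁ p) (proj₂ p) u) (components L)
  components-cover ((i , just w) ∷ L)  u (here u~w)   = here (Conn-sym u~w)
  components-cover ((i , nothing) ∷ L) u (here miss)  = contradiction here (miss u ∈⊤)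
  components-cover ((i , just w) ∷ L)  u (there cov)  = there (components-cover L u cov)
  components-cover ((i , nothing) ∷ L) u (there cov)  = components-cover L u cov

  compCover⇔hCover : ∀ k → CompCover c k ⇔ HasCover c full k
  compCover⇔hCover k = mk⇔
    (λ (L , len , cov) → map componentVertex L , ≤-trans (≤-reflexive (length-map _ L)) len
                       , All.map⁺ (All.universal (λ _ → ∈⊤) L)
                       , λ u → Any.map⁺ (Any.map Conn-sym (cov u)))
    (λ (L , len , _ , cov) → components L , ≤-trans (length-components L) len
                           , λ u → components-cover L u (cov u))

  tc≥τ : ∀ m → (∀ (c′ : Colouring G r) → CompCover c′ m) → HasCover c full m
  tc≥τ m coverable = Equivalence.to (compCover⇔hCover m) (coverable c)

  module _ (W : Subset n) where

    MeetsW : Fin r → Fin n → Set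
    MeetsW i w = ∃ λ x → x ∈ W × Conn c i w x

    MeetsW? : ∀ i w → Dec (MeetsW i w)
    MeetsW? i w = any? λ x → (x ∈? W) ×-dec Conn? i w x

    vertexIn : ∀ {i w} → Dec (MeetsW i w) → HVertex c
    vertexIn {i} (yes (x , _)) = i , just x
    vertexIn {i} (no _)        = i , nothing

    vertexIn-valid : ∀ {i w} (d : Dec (MeetsW i w)) → Valid c W (vertexIn d)
    vertexIn-valid (yes (x , x∈W , _)) = x∈W
    vertexIn-valid (no _)              = tt

    vertexIn-covers : ∀ {i w u} (d : Dec (MeetsW i w)) → Conn c i u w → InEd c W (vertexIn d) u
    vertexIn-covers (yes (x , _ , w~x)) u~w = Conn-trans u~w w~x
    vertexIn-covers (no ¬meet) u~w x x∈W u~x = ¬meet (x , x∈W , Conn-trans (Conn-sym u~w) u~x)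

    -- The vertex vt(C) of H(G,W,c) for the component C that p stands for in H(G,c).
    restrict : HVertex c → HVertex c
    restrict (i , nothing) = i , nothing
    restrict (i , just w)  = vertexIn (MeetsW? i w)

    restrict-valid : ∀ p → Valid c W (restrict p)
    restrict-valid (i , nothing) = tt
    restrict-valid (i , just w)  = vertexIn-valid (MeetsW? i w)

    restrict-covers : ∀ {p u} → InEd c full p u → InEd c W (restrict p) u
    restrict-covers {i , nothing} miss x _ = miss x ∈⊤
    restrict-covers {i , just w}  u~w      = vertexIn-covers (MeetsW? i w) u~w

    vertexIn-≡⇒SameVt : ∀ {i u v} (d : Dec (MeetsW i u)) (e : Dec (MeetsW i v)) →
                        proj₂ (vertexIn d) ≡ proj₂ (vertexIn e) → SameVt c W i u v
    vertexIn-≡⇒SameVt (yes (x , _ , u~x)) (yes (.x , _ , v~x)) refl = inj₁ (Conn-trans u~x (Conn-sym v~x))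
    vertexIn-≡⇒SameVt (no ¬u) (no ¬v) refl =
      inj₂ ((λ x x∈W u~x → ¬u (x , x∈W , u~x)) , (λ x x∈W v~x → ¬v (x , x∈W , v~x)))

    vertexIn-∈W : ∀ {i u x} (d : Dec (MeetsW i u)) → proj₂ (vertexIn d) ≡ just x → x ∈ W
    vertexIn-∈W (yes (x , x∈W , _)) refl = x∈W

  hCover-restrict : ∀ (W : Subset n) k → HasCover c full k → HasCover c W k
  hCover-restrict W k (L , len , _ , cov) =
    map (restrict W) L , ≤-trans (≤-reflexive (length-map _ L)) len
    , All.map⁺ (All.universal (restrict-valid W) L)
    , λ u → Any.map⁺ (Any.map (restrict-covers W) (cov u))

  edge⇒sharedVertex : ∀ (W : Subset n) u v → Edge G u v → ∃ λ i → SameVt c W i u v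
  edge⇒sharedVertex W u v uv = col c u v , inj₁ (step (uv , refl) here)

argmax : ∀ {m} (f : Maybe (Fin m) → ℕ) → ∃ λ k → ∀ j → f j ≤ f k
argmax {zero}  f = nothing , λ { nothing → ≤-refl }
argmax {suc m} f with argmax (f ∘ Maybe.map suc)
... | k , max with f (just zero) ≤? f (Maybe.map suc k)
...   | yes le = Maybe.map suc k , λ { nothing → max nothing
                                    ; (just zero) → le
                                    ; (just (suc x)) → max (just x) }
...   | no gt  = just zero , λ { nothing → ≤-trans (max nothing) (<⇒≤ (≰⇒> gt))
                              ; (just zero) → ≤-refl
                              ; (just (suc x)) → ≤-trans (max (just x)) (<⇒≤ (≰⇒> gt)) }

module Fibres {n m} (P : Fin n → Bool) (key : Fin n → Maybe (Fin m)) (W : Fin m → Bool)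
               (key∈W : ∀ {u x} → P u ≡ true → key u ≡ just x → W x ≡ true) where

  fibre : Maybe (Fin m) → Fin n → Bool
  fibre k u = P u ∧ does (≡-decᴹ _≟_ (key u) k)

  fibre⊆ : ∀ {k u} → fibre k u ≡ true → P u ≡ true
  fibre⊆ {u = u} u∈ with P u
  ... | true = refl

  fibre-key : ∀ {k u} → fibre k u ≡ true → key u ≡ k
  fibre-key {k} {u} u∈ with P u
  ... | true = dec-true⁻¹ (≡-decᴹ _≟_ (key u) k) u∈

  χ-fibres : ∀ u → χ (P u) ≡ χ (fibre nothing u) + ∑[ x < m ] (χ (W x) * χ (fibre (just x) u))
  χ-fibres u with P u in Pu | key u in ku
  ... | false | _       = sym (∑-zero _ λ x → *-zeroʳ (χ (W x)))
  ... | true  | nothing = sym (cong suc (∑-zero _ λ x → *-zeroʳ (χ (W x))))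
  ... | true  | just y  = sym (trans (∑-pointSupported y _ off) on)
    where
    off : ∀ x → x ≢ y → χ (W x) * χ (y ≟ᵇ x) ≡ 0
    off x x≢y rewrite ≟ᵇ-false (x≢y ∘ sym) = *-zeroʳ (χ (W x))
    on : χ (W y) * χ (y ≟ᵇ y) ≡ 1
    on rewrite ≟ᵇ-refl y | key∈W Pu ku = refl

  count-fibres : count P ≡ count (fibre nothing) + ∑[ x < m ] (χ (W x) * count (fibre (just x)))
  count-fibres = begin
    count P
      ≡⟨ sum-cong-≗ χ-fibres ⟩
    ∑[ u < n ] (χ (fibre nothing u) + ∑[ x < m ] (χ (W x) * χ (fibre (just x) u)))
      ≡⟨ ∑-distrib-+ (χ ∘ fibre nothing) _ ⟩
    count (fibre nothing) + ∑[ u < n ] ∑[ x < m ] (χ (W x) * χ (fibre (just x) u))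
      ≡⟨ cong (count (fibre nothing) +_) (∑-comm {n} {m} λ u x → χ (W x) * χ (fibre (just x) u)) ⟩
    count (fibre nothing) + ∑[ x < m ] ∑[ u < n ] (χ (W x) * χ (fibre (just x) u))
      ≡⟨ cong (count (fibre nothing) +_)
              (sum-cong-≗ λ x → sym (*-distribˡ-sum (χ (W x)) (χ ∘ fibre (just x)))) ⟩
    count (fibre nothing) + ∑[ x < m ] (χ (W x) * count (fibre (just x))) ∎
    where open ≡-Reasoning

  largest-fibre : ∃ λ k → count P ≤ suc (count W) * count (fibre k)
  largest-fibre with argmax (count ∘ fibre)
  ... | k , max = k , (begin
    count P
      ≡⟨ count-fibres ⟩
    count (fibre nothing) + ∑[ x < m ] (χ (W x) * count (fibre (just x)))
      ≤⟨ +-mono-≤ (max nothing) (∑-mono-≤ _ _ λ x → *-monoʳ-≤ (χ (W x)) (max (just x))) ⟩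
    M + ∑[ x < m ] (χ (W x) * M)
      ≡⟨ cong (M +_) (sum-cong-≗ λ x → *-comm (χ (W x)) M) ⟩
    M + ∑[ x < m ] (M * χ (W x))
      ≡⟨ cong (M +_) (sym (*-distribˡ-sum M (χ ∘ W))) ⟩
    M + M * count W
      ≡⟨ cong (M +_) (*-comm M (count W)) ⟩
    suc (count W) * M ∎)
    where
    open ≤-Reasoning
    M = count (fibre k)

  pigeonhole : ∃ λ Q → (∀ {u} → Q u ≡ true → P u ≡ true)
                     × (∀ {u v} → Q u ≡ true → Q v ≡ true → key u ≡ key v)
                     × count P ≤ suc (count W) * count Q
  pigeonhole with largest-fibre
  ... | k , bound = fibre k , fibre⊆ , (λ u∈ v∈ → trans (fibre-key u∈) (sym (fibre-key v∈))) , bound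

module _ {n r} {G : Graph n} (c : Colouring G r) (W : Subset n) where

  -- The colour-i vertex of ed(u) in H(G,W,c), with the colour forgotten.
  vt : Fin r → Fin n → Maybe (Fin n)
  vt i u = proj₂ (restrict c W (i , just u))

  uniformSubset : ∀ (is : List (Fin r)) (P : Fin n → Bool) →
    ∃ λ B → (∀ {u} → B u ≡ true → P u ≡ true)
          × (∀ {i} → i ∈ˡ is → ∀ {u v} → B u ≡ true → B v ≡ true → vt i u ≡ vt i v)
          × count P ≤ count B * suc ∣ W ∣ ^ length is
  uniformSubset []       P = P , (λ u∈ → u∈) , (λ ()) , ≤-reflexive (sym (*-identityʳ (count P)))
  uniformSubset (i ∷ is) P
    with Fibres.pigeonhole P (vt i) (lookup W)
           (λ {u} _ eq → []=⇒lookup (vertexIn-∈W c W (MeetsW? c W i u) eq))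
  ... | Q , Q⊆P , Q-uniform , P≤Q with uniformSubset is Q
  ...   | B , B⊆Q , B-uniform , Q≤B = B , (λ u∈ → Q⊆P (B⊆Q u∈)) , uniform , bound
    where
    uniform : ∀ {j} → j ∈ˡ i ∷ is → ∀ {u v} → B u ≡ true → B v ≡ true → vt j u ≡ vt j v
    uniform (here refl) u∈ v∈ = Q-uniform (B⊆Q u∈) (B⊆Q v∈)
    uniform (there j∈)  u∈ v∈ = B-uniform j∈ u∈ v∈
    q = suc ∣ W ∣
    bound : count P ≤ count B * q ^ suc (length is)
    bound = begin
      count P                            ≤⟨ P≤Q′ ⟩
      q * count Q                        ≤⟨ *-monoʳ-≤ q Q≤B ⟩
      q * (count B * q ^ length is)      ≡⟨ sym (*-assoc q (count B) _) ⟩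
      q * count B * q ^ length is        ≡⟨ cong (_* q ^ length is) (*-comm q (count B)) ⟩
      count B * q * q ^ length is        ≡⟨ *-assoc (count B) q _ ⟩
      count B * q ^ suc (length is)      ∎
      where
      open ≤-Reasoning
      P≤Q′ : count P ≤ q * count Q
      P≤Q′ = subst (λ k → count P ≤ suc k * count Q) (sym (∣∣≡count-lookup W)) P≤Q

  popularEdge : ∀ (A : Subset n) → 1 ≤ n → ∃ λ w → ∃ λ B →
    B ⊆ A × (∀ u → u ∈ B → SameEd c W u w) × ∣ A ∣ ≤ ∣ B ∣ * (suc ∣ W ∣) ^ r
  popularEdge A n≥1 with uniformSubset (allFin r) (lookup A)
  ... | B , B⊆A , B-uniform , A≤B = w , tabulate B , sub , same , bound
    where
    sub : tabulate B ⊆ A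
    sub u∈ = lookup⇒[]= _ A (B⊆A (∈-tabulate⁻ u∈))
    bound : ∣ A ∣ ≤ ∣ tabulate B ∣ * (suc ∣ W ∣) ^ r
    bound rewrite ∣∣≡count-lookup A | ∣tabulate∣≡count B | length-tabulate {A = Fin r} (λ i → i)
      = A≤B
    sameAs : ∀ {u w} → B u ≡ true → B w ≡ true → SameEd c W u w
    sameAs {u} {w} u∈ w∈ i = vertexIn-≡⇒SameVt c W (MeetsW? c W i u) (MeetsW? c W i w)
                               (B-uniform (∈-allFin i) u∈ w∈)
    w = proj₁ (pickMember n≥1 B)
    same : ∀ u → u ∈ tabulate B → SameEd c W u w
    same u u∈ = sameAs (∈-tabulate⁻ u∈) (proj₂ (pickMember n≥1 B) (∈-tabulate⁻ u∈))

-- The number of orderings of an N-set in which a given a-subset entirely precedes a given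
-- disjoint b-subset (meaningful for a + b ≤ N).
ω : ℕ → ℕ → ℕ → ℕ
ω N a b = (a ! * b ! * N !) / (a + b) !
  where instance _ = (a + b) !≢0

ω-spec : ∀ N a b → a + b ≤ N → ω N a b * (a + b) ! ≡ a ! * b ! * N !
ω-spec N a b a+b≤N = m/n*n≡m (∣-trans (m≤n⇒m!∣n! a+b≤N) (n∣m*n (a ! * b !)))
  where instance _ = (a + b) !≢0

ω-zero : ∀ N a → a ≤ N → ω N a 0 ≡ N !
ω-zero N a a≤N = *-cancelʳ-≡ (ω N a 0) (N !) ((a + 0) !) {{(a + 0) !≢0}} (begin
  ω N a 0 * (a + 0) !   ≡⟨ ω-spec N a 0 (subst (_≤ N) (sym (+-identityʳ a)) a≤N) ⟩
  a ! * 1 * N !         ≡⟨ cong (_* N !) (*-identityʳ (a !)) ⟩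
  a ! * N !             ≡⟨ *-comm (a !) (N !) ⟩
  N ! * a !             ≡⟨ cong (λ t → N ! * t !) (sym (+-identityʳ a)) ⟩
  N ! * (a + 0) !       ∎)
  where open ≡-Reasoning

-- Classify the orderings counted on the right by their last element, which lies in the
-- (b + 1)-subset or is one of the ρ elements outside both subsets.
ω-last : ∀ a b ρ → let M = a + b + ρ in
         suc b * ω M a b + ρ * ω M a (suc b) ≡ ω (suc M) a (suc b)
ω-last a b ρ = *-cancelʳ-≡ _ _ (suc t * t !) {{m*n≢0 (suc t) (t !) {{_}} {{t !≢0}}}} (begin
  (suc b * X + ρ * Y) * (suc t * t !)
    ≡⟨ distribute (suc b) ρ X Y t (t !) ⟩
  suc b * suc t * (X * t !) + ρ * (Y * (suc t * t !))
    ≡⟨ cong₂ (λ p q → suc b * suc t * p + q) (ω-spec M a b a+b≤M) (ρY-spec ρ) ⟩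
  suc b * suc t * (a ! * b ! * M !) + ρ * (a ! * (suc b * b !) * M !)
    ≡⟨ collect a b ρ (a !) (b !) (M !) ⟩
  a ! * (suc b * b !) * (suc (a + b + ρ) * M !)
    ≡⟨ sym Z-spec ⟩
  ω (suc M) a (suc b) * (suc t * t !) ∎)
  where
  open ≡-Reasoning
  t = a + b
  M = t + ρ
  X = ω M a b
  Y = ω M a (suc b)
  a+b≤M : t ≤ M
  a+b≤M = m≤m+n t ρ
  a+sb≡st : a + suc b ≡ suc t
  a+sb≡st = +-suc a b
  spec-suc : ∀ N → suc t ≤ N → ω N a (suc b) * (suc t * t !) ≡ a ! * (suc b * b !) * N !
  spec-suc N le = subst (λ s → ω N a (suc b) * s ! ≡ a ! * (suc b * b !) * N !) a+sb≡st
    (ω-spec N a (suc b) (subst (_≤ N) (sym a+sb≡st) le))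
  -- For ρ = 0 the value of Y is junk (a + suc b ≤ M fails), but it is multiplied by 0.
  ρY-spec : ∀ ρ → ρ * (ω (t + ρ) a (suc b) * (suc t * t !)) ≡ ρ * (a ! * (suc b * b !) * (t + ρ) !)
  ρY-spec zero     = refl
  ρY-spec (suc ρ′) = cong (suc ρ′ *_)
    (spec-suc (t + suc ρ′) (subst (suc t ≤_) (sym (+-suc t ρ′)) (s≤s (m≤m+n t ρ′))))
  Z-spec : ω (suc M) a (suc b) * (suc t * t !) ≡ a ! * (suc b * b !) * (suc M * M !)
  Z-spec = spec-suc (suc M) (s≤s a+b≤M)
  distribute : ∀ β ρ X Y s f →
               (β * X + ρ * Y) * (suc s * f) ≡ β * suc s * (X * f) + ρ * (Y * (suc s * f))
  distribute = solve-∀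
  collect : ∀ a b ρ A B K → suc b * suc (a + b) * (A * B * K) + ρ * (A * (suc b * B) * K)
                          ≡ A * (suc b * B) * (suc (a + b + ρ) * K)
  collect = solve-∀

C*factorials : ∀ a b → ((a + b) C a) * (a ! * b !) ≡ (a + b) !
C*factorials a b = subst (λ d → ((a + b) C a) * (a ! * d !) ≡ (a + b) !) (m+n∸m≡n a b)
  (trans (cong (_* (a ! * (a + b ∸ a) !)) (nCk≡n!/k![n-k]! a≤a+b))
         (m/n*n≡m {{a !* (a + b ∸ a) !≢0}} (k![n∸k]!∣n! a≤a+b)))
  where
  a≤a+b : a ≤ a + b
  a≤a+b = m≤m+n a b

ω*C : ∀ N a b → a + b ≤ N → ω N a b * ((a + b) C a) ≡ N !
ω*C N a b a+b≤N = *-cancelʳ-≡ _ _ (a ! * b !) {{m*n≢0 (a !) (b !) {{a !≢0}} {{b !≢0}}}} (begin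
  ω N a b * ((a + b) C a) * (a ! * b !)     ≡⟨ *-assoc (ω N a b) _ _ ⟩
  ω N a b * (((a + b) C a) * (a ! * b !))   ≡⟨ cong (ω N a b *_) (C*factorials a b) ⟩
  ω N a b * (a + b) !                     ≡⟨ ω-spec N a b a+b≤N ⟩
  a ! * b ! * N !                         ≡⟨ *-comm (a ! * b !) (N !) ⟩
  N ! * (a ! * b !)                       ∎)
  where open ≡-Reasoning

C-monoˡ : ∀ k {n n′} → n ≤ n′ → n C k ≤ n′ C k
C-monoˡ k {n} {n′} n≤n′ = subst (λ x → n C k ≤ x C k) (m+[n∸m]≡n n≤n′) (grow (n′ ∸ n))
  where
  mC0≡1 : ∀ m → m C 0 ≡ 1
  mC0≡1 m = trans (nCk≡nC[n∸k] {0} {m} z≤n) (nCn≡1 m)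
  C-suc : ∀ m j → m C j ≤ suc m C j
  C-suc m zero    = ≤-reflexive (trans (mC0≡1 m) (sym (mC0≡1 (suc m))))
  C-suc m (suc j) = ≤-trans (m≤n+m (m C suc j) (m C j)) (≤-reflexive (nCk+nC[k+1]≡[n+1]C[k+1] m j))
  grow : ∀ d → n C k ≤ (n + d) C k
  grow zero    rewrite +-identityʳ n = ≤-refl
  grow (suc d) rewrite +-suc n d = ≤-trans (grow d) (C-suc (n + d) k)

module _ {m : ℕ} where

  ∑-ω-byLast : ∀ N {U A B : Fin m → Bool} b → count U ≡ suc N →
    (∀ {z} → A z ≡ true → U z ≡ true) → (∀ {z} → B z ≡ true → U z ≡ true) →
    (∀ {z} → A z ≡ true → B z ≢ true) → count B ≡ suc b →
    ∑[ x < m ] (χ (U x) * (χ (not (A x)) * ω N (count A) (count (B ─ x))))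
      ≡ ω (suc N) (count A) (count B)
  ∑-ω-byLast N {U} {A} {B} b |U| A⊆U B⊆U A∩B |B| = begin
    ∑[ x < m ] (χ (U x) * (χ (not (A x)) * ω N a (count (B ─ x))))
      ≡⟨ sum-cong-≗ term ⟩
    ∑[ x < m ] (χ (B x) * ω N a b + χ (R x) * ω N a (suc b))
      ≡⟨ ∑-distrib-+ (λ x → χ (B x) * ω N a b) _ ⟩
    ∑[ x < m ] (χ (B x) * ω N a b) + ∑[ x < m ] (χ (R x) * ω N a (suc b))
      ≡⟨ cong₂ _+_ (∑-*ʳ (χ ∘ B) _) (∑-*ʳ (χ ∘ R) _) ⟩
    count B * ω N a b + count R * ω N a (suc b)
      ≡⟨ cong (λ β → β * ω N a b + count R * ω N a (suc b)) |B| ⟩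
    suc b * ω N a b + count R * ω N a (suc b)
      ≡⟨ recurrence ⟩
    ω (suc N) a (suc b)
      ≡⟨ cong (ω (suc N) a) (sym |B|) ⟩
    ω (suc N) a (count B) ∎
    where
    open ≡-Reasoning
    a = count A
    R : Fin m → Bool
    R z = U z ∧ not (A z) ∧ not (B z)
    |B─x| : ∀ x → count (B ─ x) ≡ (if B x then b else suc b)
    |B─x| x with B x in Bx | count-remove B x
    ... | true  | eq = sym (suc-injective (trans (sym |B|) eq))
    ... | false | eq = trans (sym eq) |B|
    term : ∀ x → χ (U x) * (χ (not (A x)) * ω N a (count (B ─ x)))
               ≡ χ (B x) * ω N a b + χ (R x) * ω N a (suc b)
    term x rewrite |B─x| x with B x in Bx | A x in Ax | U x in Ux
    ... | true  | true  | _     = contradiction Bx (A∩B Ax)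
    ... | true  | false | false = contradiction (trans (sym (B⊆U Bx)) Ux) λ ()
    ... | true  | false | true  = refl
    ... | false | true  | true  = refl
    ... | false | true  | false = refl
    ... | false | false | true  = +-identityʳ _
    ... | false | false | false = refl
    partition : ∀ x → χ (U x) ≡ χ (A x) + χ (B x) + χ (R x)
    partition x with A x in Ax | B x in Bx | U x in Ux
    ... | true  | true  | _     = contradiction Bx (A∩B Ax)
    ... | true  | false | true  = refl
    ... | true  | false | false = contradiction (trans (sym (A⊆U Ax)) Ux) λ ()
    ... | false | true  | true  = refl
    ... | false | true  | false = contradiction (trans (sym (B⊆U Bx)) Ux) λ ()
    ... | false | false | true  = refl
    ... | false | false | false = refl
    N≡ : N ≡ a + b + count R
    N≡ = suc-injective (begin
      suc N                       ≡⟨ sym |U| ⟩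
      count U                     ≡⟨ sum-cong-≗ partition ⟩
      ∑[ x < m ] (χ (A x) + χ (B x) + χ (R x))
                                  ≡⟨ ∑-distrib-+ (λ x → χ (A x) + χ (B x)) (χ ∘ R) ⟩
      ∑[ x < m ] (χ (A x) + χ (B x)) + count R
                                  ≡⟨ cong (_+ count R) (∑-distrib-+ (χ ∘ A) (χ ∘ B)) ⟩
      a + count B + count R       ≡⟨ cong (λ β → a + β + count R) |B| ⟩
      a + suc b + count R         ≡⟨ cong (_+ count R) (+-suc a b) ⟩
      suc (a + b + count R)       ∎)
    recurrence : suc b * ω N a b + count R * ω N a (suc b) ≡ ω (suc N) a (suc b)
    recurrence = subst (λ M → suc b * ω M a b + count R * ω M a (suc b) ≡ ω (suc M) a (suc b))
                       (sym N≡) (ω-last a b (count R))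

module _ {m k : ℕ} where

  record IsSetPairSystem (U : Fin m → Bool) (I : Fin k → Bool) (A B : Fin k → Fin m → Bool) : Set where
    field
      A⊆U      : ∀ {i z} → I i ≡ true → A i z ≡ true → U z ≡ true
      B⊆U      : ∀ {i z} → I i ≡ true → B i z ≡ true → U z ≡ true
      disjoint : ∀ {i z} → I i ≡ true → A i z ≡ true → B i z ≢ true
      cross    : ∀ {i j} → I i ≡ true → I j ≡ true → i ≢ j →
                 ∃ λ z → A i z ≡ true × B j z ≡ true

  count-A≤ : ∀ {U I A B} → IsSetPairSystem U I A B → ∀ {i} → I i ≡ true → count (A i) ≤ count U
  count-A≤ {U} {A = A} sys {i} i∈ = count-mono {P = A i} {U} (IsSetPairSystem.A⊆U sys i∈)

  count-B≤ : ∀ {U I A B} → IsSetPairSystem U I A B → ∀ {i} → I i ≡ true → count (B i) ≤ count U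
  count-B≤ {U} {B = B} sys {i} i∈ = count-mono {P = B i} {U} (IsSetPairSystem.B⊆U sys i∈)

  weight : ℕ → (Fin k → Bool) → (A B : Fin k → Fin m → Bool) → ℕ
  weight N I A B = ∑[ i < k ] (χ (I i) * ω N (count (A i)) (count (B i)))

  -- Orderings whose last element is x: the pairs with x ∈ A drop out.
  deleteLast : ∀ {U I A B} → IsSetPairSystem U I A B → ∀ x →
               IsSetPairSystem (U ─ x) (λ i → I i ∧ not (A i x)) A (λ i → B i ─ x)
  deleteLast {U} {I} {A} {B} sys x = record
    { A⊆U      = λ i∈ Aiz → ─-intro {P = U} (A⊆U (i∈I i∈) Aiz) (z≢x i∈ Aiz)
    ; B⊆U      = λ {i} i∈ Biz → let Biz′ , z≢x′ = ─-elim {P = B i} Biz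
                                in ─-intro {P = U} (B⊆U (i∈I i∈) Biz′) z≢x′
    ; disjoint = λ {i} i∈ Aiz Biz → disjoint (i∈I i∈) Aiz (proj₁ (─-elim {P = B i} Biz))
    ; cross    = λ {i} {j} i∈ j∈ i≢j → let z , Aiz , Bjz = cross (i∈I i∈) (i∈I j∈) i≢j
                                       in z , Aiz , ─-intro {P = B j} Bjz (z≢x i∈ Aiz)
    }
    where
    open IsSetPairSystem sys
    i∈I : ∀ {i} → (I i ∧ not (A i x)) ≡ true → I i ≡ true
    i∈I {i} i∈ = proj₁ (∧-true⁻ {I i} i∈)
    z≢x : ∀ {i z} → (I i ∧ not (A i x)) ≡ true → A i z ≡ true → z ≢ x
    z≢x {i} i∈ Aiz refl with A i x | proj₂ (∧-true⁻ {I i} i∈)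
    ... | true  | ()
    ... | false | _ = contradiction Aiz λ ()

  mutual
    bollobás : ∀ N {U I A B} → count U ≡ N → IsSetPairSystem U I A B → weight N I A B ≤ N !
    bollobás N {U} {I} {A} {B} |U| sys with any? (λ i → (I i ≟𝔹 true) ×-dec (count (B i) ≟ℕ 0))
    ... | yes (i₀ , i₀∈ , |B₀|) = ≤-reflexive (begin
      weight N I A B           ≡⟨ ∑-pointSupported i₀ _ others ⟩
      χ (I i₀) * ω N a₀ (count (B i₀))
                               ≡⟨ cong₂ (λ b β → χ b * ω N a₀ β) i₀∈ |B₀| ⟩
      1 * ω N a₀ 0             ≡⟨ *-identityˡ _ ⟩
      ω N a₀ 0                 ≡⟨ ω-zero N a₀ (≤-trans (count-A≤ sys i₀∈) (≤-reflexive |U|)) ⟩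
      N !                      ∎)
      where
      open ≡-Reasoning
      open IsSetPairSystem sys
      a₀ = count (A i₀)
      -- Every other pair would need its A to meet the empty B i₀.
      others : ∀ j → j ≢ i₀ → χ (I j) * ω N (count (A j)) (count (B j)) ≡ 0
      others j j≢i₀ with I j in j∈
      ... | false = refl
      ... | true  = let z , _ , B₀z = cross j∈ i₀∈ j≢i₀
                    in contradiction B₀z (count≡0⇒∉ |B₀| z)
    ... | no ¬empty = bollobás-nonempty N |U| sys nonempty
      where
      nonempty : ∀ {i} → I i ≡ true → ∃ λ b → count (B i) ≡ suc b
      nonempty {i} i∈ with count (B i) in |B|
      ... | zero  = contradiction (i , i∈ , |B|) ¬empty
      ... | suc b = b , refl

    bollobás-nonempty : ∀ N {U I A B} → count U ≡ N → IsSetPairSystem U I A B →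
                        (∀ {i} → I i ≡ true → ∃ λ b → count (B i) ≡ suc b) → weight N I A B ≤ N !
    bollobás-nonempty zero {U} {I} {A} {B} |U| sys nonempty =
      ≤-trans (≤-reflexive (∑-zero _ noPair)) z≤n
      where
      noPair : ∀ i → χ (I i) * ω zero (count (A i)) (count (B i)) ≡ 0
      noPair i with I i in i∈
      ... | false = refl
      ... | true  = let b , |B| = nonempty i∈
                    in contradiction (subst (_≤ 0) |B| (subst (count (B i) ≤_) |U| (count-B≤ sys i∈))) λ ()
    bollobás-nonempty (suc N) {U} {I} {A} {B} |U| sys nonempty = begin
      weight (suc N) I A B
        ≡⟨ sum-cong-≗ byLast ⟩
      ∑[ i < k ] ∑[ x < m ] term i x
        ≡⟨ ∑-comm term ⟩
      ∑[ x < m ] ∑[ i < k ] term i x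
        ≡⟨ sum-cong-≗ (λ x → sym (*-distribˡ-sum (χ (U x)) (afterDeleting x))) ⟩
      ∑[ x < m ] (χ (U x) * weight N (λ i → I i ∧ not (A i x)) A (λ i → B i ─ x))
        ≤⟨ ∑-mono-≤ _ _ induction ⟩
      ∑[ x < m ] (χ (U x) * N !)
        ≡⟨ ∑-*ʳ (χ ∘ U) (N !) ⟩
      count U * N !
        ≡⟨ cong (_* N !) |U| ⟩
      suc N * N ! ∎
      where
      open ≤-Reasoning
      open IsSetPairSystem sys
      afterDeleting : Fin m → Fin k → ℕ
      afterDeleting x i = χ (I i ∧ not (A i x)) * ω N (count (A i)) (count (B i ─ x))
      term : Fin k → Fin m → ℕ
      term i x = χ (U x) * afterDeleting x i
      byLast : ∀ i → χ (I i) * ω (suc N) (count (A i)) (count (B i)) ≡ ∑[ x < m ] term i x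
      byLast i with I i in i∈
      ... | false = sym (∑-zero _ λ x → *-zeroʳ (χ (U x)))
      ... | true  = let b , |B| = nonempty i∈ in
        trans (*-identityˡ _)
              (sym (∑-ω-byLast N {U} {A i} {B i} b |U| (A⊆U i∈) (B⊆U i∈) (disjoint i∈) |B|))
      induction : ∀ x → χ (U x) * weight N (λ i → I i ∧ not (A i x)) A (λ i → B i ─ x)
                      ≤ χ (U x) * N !
      induction x with U x in Ux
      ... | false = z≤n
      ... | true  = *-monoʳ-≤ 1
        (bollobás N (suc-injective (trans (sym (count-remove-∈ U Ux)) |U|)) (deleteLast sys x))

+-<⇒≤∸1+ : ∀ a {b c} → b < c → a + b ≤ (a ∸ 1) + c
+-<⇒≤∸1+ zero        b<c = <⇒≤ b<c
+-<⇒≤∸1+ (suc a) {b} {c} b<c = subst (_≤ a + c) (+-suc a b) (+-monoʳ-≤ a b<c)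

module _ {n r} {G : Graph n} (c : Colouring G r) (s : ℕ) where

  -- A point z of Fin (r * n) encodes remQuot n z = (i , x): the colour-i component with
  -- representative x, so that ed w is the edge ed(w) of H(G,c).
  ed : Fin n → Fin (r * n) → Bool
  ed w z = proj₂ (remQuot {r} n z) ≟ᵇ rep c (proj₁ (remQuot {r} n z)) w

  ed-combine : ∀ w i x → ed w (combine i x) ≡ (x ≟ᵇ rep c i w)
  ed-combine w i x = cong (λ p → proj₂ p ≟ᵇ rep c (proj₁ p) w) (remQuot-combine {r} {n} i x)

  count-ed : ∀ w → count (ed w) ≡ r
  count-ed w = begin
    count (ed w)                                  ≡⟨ ∑-combine r n (χ ∘ ed w) ⟩
    ∑[ i < r ] ∑[ x < n ] χ (ed w (combine i x))
                      ≡⟨ sum-cong-≗ (λ i → sum-cong-≗ λ x → cong χ (ed-combine w i x)) ⟩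
    ∑[ i < r ] count (_≟ᵇ rep c i w)              ≡⟨ sum-cong-≗ (λ i → count-singleton (rep c i w)) ⟩
    ∑[ i < r ] 1                                  ≡⟨ count-all r ⟩
    r                                             ∎
    where open ≡-Reasoning

  Covers : (Fin (r * n) → Bool) → (Fin n → Bool) → Set
  Covers T W = ∀ w → W w ≡ true → ∃ λ z → T z ≡ true × ed w z ≡ true

  covers? : ∀ T W → Dec (Covers T W)
  covers? T W = all? λ w → (W w ≟𝔹 true) →-dec any? λ z → (T z ≟𝔹 true) ×-dec (ed w z ≟𝔹 true)

  HasSmallCover : (Fin n → Bool) → Set
  HasSmallCover W = ∃ λ (T : Subset (r * n)) → Covers (lookup T) W × ∣ T ∣ < s

  smallCover? : ∀ W → Dec (HasSmallCover W)
  smallCover? W = anySubset? λ T → covers? (lookup T) W ×-dec (suc ∣ T ∣ ≤? s)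

  Critical : (Fin n → Bool) → Set
  Critical W = ¬ HasSmallCover W × (∀ {w} → W w ≡ true → HasSmallCover (W ─ w))

  critical-below : ∀ k W → count W ≤ k → ¬ HasSmallCover W → ∃ Critical
  critical-below k W |W|≤k ¬small
    with any? (λ w → (W w ≟𝔹 true) ×-dec ¬? (smallCover? (W ─ w)))
  ... | no ¬shrinkable = W , ¬small , shrink
    where
    shrink : ∀ {w} → W w ≡ true → HasSmallCover (W ─ w)
    shrink {w} w∈ with smallCover? (W ─ w)
    ... | yes small  = small
    ... | no ¬small′ = contradiction (w , w∈ , ¬small′) ¬shrinkable
  ... | yes (w , w∈ , ¬small′) with k
  ...   | zero   = contradiction (subst (_≤ 0) (count-remove-∈ W w∈) |W|≤k) λ ()
  ...   | suc k′ =
    critical-below k′ (W ─ w) (≤-pred (subst (_≤ suc k′) (count-remove-∈ W w∈) |W|≤k)) ¬small′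

  componentOf : Fin (r * n) → HVertex c
  componentOf z = componentVertex c (remQuot {r} n z)

  noSmallCover : τ≥ c full s → ¬ HasSmallCover (λ _ → true)
  noSmallCover τ≥s (T , covers , |T|<s) =
    <⇒≱ |T|<s (subst (s ≤_) |L|≡|T| (τ≥s _ (L , ≤-refl , valid , coverAll)))
    where
    L = map componentOf (members (lookup T))
    |L|≡|T| : length L ≡ ∣ T ∣
    |L|≡|T| = trans (length-map componentOf (members (lookup T)))
                    (trans (length-members (lookup T)) (sym (∣∣≡count-lookup T)))
    valid : All (Valid c full) L
    valid = All.map⁺ (All.universal (λ _ → ∈⊤) _)
    coverAll : ∀ u → Any (λ p → InEd c full p u) L
    coverAll u = let z , z∈T , u∈z = covers u refl in
      lose (∈-map⁺ componentOf (∈-members (lookup T) z∈T))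
           (subst (Conn c _ u) (sym (≟ᵇ-true u∈z)) (Conn-rep c _ u))

  module _ {W : Fin n → Bool} (critical : Critical W) where

    smallCoverOf : Fin n → Subset (r * n)
    smallCoverOf w with smallCover? (W ─ w)
    ... | yes (T , _) = T
    ... | no _        = ∅

    smallCoverOf-spec : ∀ {w} → W w ≡ true →
                        Covers (lookup (smallCoverOf w)) (W ─ w) × ∣ smallCoverOf w ∣ < s
    smallCoverOf-spec {w} w∈ with smallCover? (W ─ w)
    ... | yes (_ , covers , small) = covers , small
    ... | no ¬small                = contradiction (proj₂ critical w∈) ¬small

    B : Fin n → Fin (r * n) → Bool
    B w = lookup (smallCoverOf w)

    -- A small cover of W ─ w meeting ed(w) would be a small cover of W.
    B-misses-ed : ∀ {w z} → W w ≡ true → ed w z ≡ true → B w z ≢ true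
    B-misses-ed {w} {z} w∈ w∈z z∈B =
      proj₁ critical (smallCoverOf w , coversW , proj₂ (smallCoverOf-spec w∈))
      where
      coversW : Covers (B w) W
      coversW v v∈ with v ≟ w
      ... | yes refl = z , z∈B , w∈z
      ... | no v≢w   = proj₁ (smallCoverOf-spec w∈) v (─-intro {P = W} v∈ v≢w)

    setPairSystem : IsSetPairSystem (λ _ → true) W ed B
    setPairSystem = record
      { A⊆U      = λ _ _ → refl
      ; B⊆U      = λ _ _ → refl
      ; disjoint = B-misses-ed
      ; cross    = λ {w} {w′} w∈ w′∈ w≢w′ →
          let z , z∈B , w∈z = proj₁ (smallCoverOf-spec w′∈) w (─-intro {P = W} w∈ w≢w′)
          in z , w∈z , z∈B
      }

    critical-size : count W ≤ N r s
    critical-size = *-cancelʳ-≤ (count W) (N r s) (M !) {{M !≢0}} (begin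
      count W * M !                           ≡⟨ ∑-*ʳ (χ ∘ W) (M !) ⟨
      ∑[ w < n ] (χ (W w) * M !)              ≤⟨ ∑-mono-≤ _ _ perVertex ⟩
      ∑[ w < n ] (weightOf w * N r s)         ≡⟨ ∑-*ʳ weightOf (N r s) ⟩
      weight M W ed B * N r s
        ≤⟨ *-monoˡ-≤ (N r s) (bollobás M {λ _ → true} (count-all M) setPairSystem) ⟩
      M ! * N r s                             ≡⟨ *-comm (M !) (N r s) ⟩
      N r s * M !                             ∎)
      where
      open ≤-Reasoning
      M = r * n
      weightOf : Fin n → ℕ
      weightOf w = χ (W w) * ω M (count (ed w)) (count (B w))
      perVertex : ∀ w → χ (W w) * M ! ≤ weightOf w * N r s
      perVertex w with W w in w∈
      ... | false = z≤n
      ... | true  rewrite count-ed w = begin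
        1 * M !                            ≡⟨ *-identityˡ (M !) ⟩
        M !                                ≡⟨ ω*C M r b r+b≤M ⟨
        ω M r b * ((r + b) C r)            ≤⟨ *-monoʳ-≤ (ω M r b) (C-monoˡ r (+-<⇒≤∸1+ r b<s)) ⟩
        ω M r b * N r s                    ≡⟨ cong (_* N r s) (*-identityˡ (ω M r b)) ⟨
        1 * ω M r b * N r s                ∎
        where
        b = count (B w)
        b<s : b < s
        b<s = subst (_< s) (∣∣≡count-lookup (smallCoverOf w)) (proj₂ (smallCoverOf-spec w∈))
        r+b≤M : r + b ≤ M
        r+b≤M = subst (λ a → a + b ≤ M) (count-ed w) (count-disjoint (ed w) (B w) (B-misses-ed w∈))

    codesOf : List (HVertex c) → Fin (r * n) → Bool
    codesOf []                  z = false
    codesOf ((i , just x) ∷ L)  z = (z ≟ᵇ combine i (rep c i x)) ∨ codesOf L z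
    codesOf ((i , nothing) ∷ L) z = codesOf L z

    count-codesOf : ∀ L → count (codesOf L) ≤ length L
    count-codesOf []                  = ≤-reflexive (∑-zero {r * n} (λ _ → 0) λ _ → refl)
    count-codesOf ((i , nothing) ∷ L) = m≤n⇒m≤1+n (count-codesOf L)
    count-codesOf ((i , just x) ∷ L)  = begin
      count (codesOf ((i , just x) ∷ L))           ≤⟨ count-∨ (_≟ᵇ z) (codesOf L) ⟩
      count (_≟ᵇ z) + count (codesOf L)            ≡⟨ cong (_+ count (codesOf L)) (count-singleton z) ⟩
      suc (count (codesOf L))                      ≤⟨ s≤s (count-codesOf L) ⟩
      suc (length L)                               ∎
      where
      open ≤-Reasoning
      z = combine i (rep c i x)

    -- Since w ∈ W, the cover cannot use a special vertex v_i^* for ed(w).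
    codesOf-covers : ∀ L {w} → W w ≡ true → Any (λ p → InEd c (tabulate W) p w) L →
                     ∃ λ z → codesOf L z ≡ true × ed w z ≡ true
    codesOf-covers ((i , just x) ∷ L) {w} w∈ (here w~x) =
      z , cong (_∨ codesOf L z) (≟ᵇ-refl z) ,
      trans (ed-combine w i (rep c i x))
            (subst (λ y → (rep c i x ≟ᵇ y) ≡ true) (sym (rep-cong c i w~x)) (≟ᵇ-refl (rep c i x)))
      where z = combine i (rep c i x)
    codesOf-covers ((i , nothing) ∷ L) w∈ (here miss) = contradiction here (miss _ (∈-tabulate⁺ w∈))
    codesOf-covers ((i , just x) ∷ L) w∈ (there cov) =
      let z , z∈ , w∈z = codesOf-covers L w∈ cov
      in z , trans (cong ((z ≟ᵇ combine i (rep c i x)) ∨_) z∈) (∨-zeroʳ _) , w∈z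
    codesOf-covers ((i , nothing) ∷ L) w∈ (there cov) = codesOf-covers L w∈ cov

    critical-τ : τ≥ c (tabulate W) s
    critical-τ k (L , |L|≤k , _ , cov) with s ≤? count (codesOf L)
    ... | yes s≤ = ≤-trans s≤ (≤-trans (count-codesOf L) |L|≤k)
    ... | no s≰  = contradiction (tabulate (codesOf L) , covers , small) (proj₁ critical)
      where
      covers : Covers (lookup (tabulate (codesOf L))) W
      covers w w∈ = let z , z∈ , w∈z = codesOf-covers L w∈ (cov w)
                  in z , trans (lookup∘tabulate (codesOf L) z) z∈ , w∈z
      small : ∣ tabulate (codesOf L) ∣ < s
      small = subst (_< s) (sym (∣tabulate∣≡count (codesOf L))) (≰⇒> s≰)

  smallWitnessSet : τ≥ c full s → ∃ λ (W : Subset n) → ∣ W ∣ ≤ N r s × τ≥ c W s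
  smallWitnessSet τ≥s with critical-below n (λ _ → true) (count≤ _) (noSmallCover τ≥s)
  ... | W , critical = tabulate W , subst (_≤ N r s) (sym (∣tabulate∣≡count W)) (critical-size critical)
                     , critical-τ critical

lemma3p1 : ∀ {n r : ℕ} (G : Graph n) (c : Colouring G r) →
    (∀ k → CompCover c k ⇔ HasCover c full k)
    × (∀ m → (∀ (c′ : Colouring G r) → CompCover c′ m) → HasCover c full m)
    × (∀ (W : Subset n) k → HasCover c full k → HasCover c W k)
    × (∀ s → τ≥ c full s → ∃ λ (W : Subset n) → ∣ W ∣ ≤ N r s × τ≥ c W s)
    × (∀ (W : Subset n) (u v : Fin n) → Edge G u v → ∃ λ (i : Fin r) → SameVt c W i u v)
    × (∀ (W A : Subset n) → 1 ≤ n → ∃ λ (w : Fin n) → ∃ λ (B : Subset n) →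
    B ⊆ A × (∀ u → u ∈ B → SameEd c W u w) × ∣ A ∣ ≤ ∣ B ∣ * (suc ∣ W ∣) ^ r)
lemma3p1 G c =
  compCover⇔hCover c
  , tc≥τ c
  , hCover-restrict c
  , smallWitnessSet c
  , edge⇒sharedVertex c
  , popularEdge c
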